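{- Let $G_1$, $G_2$ be finite groups written additively, $H$ a subgroup of $G_1$, and $k\ge 2$ an integer. If there exist a $(G_1,H,k,1)$-BRDF and a $(G_2,k,1)$-HDM, then there exists a $(G_1\times G_2, H\times G_2, k,1)$-BRDF.
   Context: Let $G$ be a finite group written additively, $H$ a subgroup, $k\ge2$, $\lambda\ge1$. A $(G,H,k,\lambda)$-RDF is a set $\mathcal{F}$ of $k$-subsets of $G$ (base blocks) such that the multiset of differences $x-y$, over ordered pairs of distinct elements $x,y$ in a common base block, contains each element of $G\setminus H$ exactly $\lambda$ times and no element of $H$. A $(G,H,k,\lambda)$-BRDF is such an RDF for which additionally every base block is disjoint from $H$, and the sets $B$ and $-B=\{ -b:b\in B\}$, $B\in\mathcal{F}$, are pairwise disjoint (including $B\cap-B=\emptyset$). A $(G,k,1)$ difference matrix (DM) is a $k\times|G|$ matrix with entries in $G$ such that, for any two distinct rows, the entrywise difference is a permutation of the elements of $G$; it is homogeneous (an HDM) if additionally every row is a permutation of the elements of $G$. -}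

module Defs where

open import Level using (Level; _⊔_)
open import Data.Nat using (ℕ; suc; _≥_)
open import Data.Fin using (Fin; _≟_)
open import Data.List using (List; []; _∷_; length; filter; concatMap; allFin)
open import Data.Product using (Σ; ∃; ∃-syntax; _×_; _,_; proj₁; proj₂)
open import Relation.Nullary using (¬_; yes; no)
open import Relation.Nullary.Decidable using (_×-dec_)
open import Relation.Binary using (Decidable)
open import Relation.Binary.PropositionalEquality using (_≡_; _≢_)
open import Function.Definitions using (Injective; Bijective)
open import Algebra.Bundles using (Group)
import Algebra.Construct.DirectProduct as DP

private variable
  c ℓ c₁ ℓ₁ c₂ ℓ₂ h : Level

module _ (G : Group c ℓ) where
  open Group G

  diff : Carrier → Carrier → Carrier
  diff x y = x ∙ (y ⁻¹)

  record IsSubgroup (H : Carrier → Set h) : Set (c ⊔ ℓ ⊔ h) where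
    field
      resp  : ∀ {x y} → x ≈ y → H x → H y
      ε∈    : H ε
      ∙∈    : ∀ {x y} → H x → H y → H (x ∙ y)
      ⁻¹∈   : ∀ {x} → H x → H (x ⁻¹)

  IsFinite : Set (c ⊔ ℓ)
  IsFinite = ∃[ n ] Σ (Fin n → Carrier) (Bijective _≡_ _≈_)

  IsKSubset : (k : ℕ) → (Fin k → Carrier) → Set ℓ
  IsKSubset k B = Injective _≡_ _≈_ B

  diffList : {m k : ℕ} → (Fin m → Fin k → Carrier) → List Carrier
  diffList {m} {k} F =
    concatMap (λ t → concatMap (λ i → concatMap (λ j → pick t i j (i ≟ j))
      (allFin k)) (allFin k)) (allFin m)
    where
      pick : (t : Fin m) (i j : Fin k) → _ → List Carrier
      pick t i j (yes _) = []
      pick t i j (no _)  = diff (F t i) (F t j) ∷ []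

  module _ (_≈?_ : Decidable _≈_) where

    multiplicity : {m k : ℕ} → (Fin m → Fin k → Carrier) → Carrier → ℕ
    multiplicity F g = length (filter (λ x → x ≈? g) (diffList F))

    IsRDF : (H : Carrier → Set h) (k λ' : ℕ) {m : ℕ}
            → (Fin m → Fin k → Carrier) → Set (c ⊔ ℓ ⊔ h)
    IsRDF H k λ' F =
      (∀ t → IsKSubset k (F t))
      × (∀ g → ¬ H g → multiplicity F g ≡ λ')
      × (∀ g → H g → multiplicity F g ≡ 0)

    IsBRDF : (H : Carrier → Set h) (k λ' : ℕ) {m : ℕ}
             → (Fin m → Fin k → Carrier) → Set (c ⊔ ℓ ⊔ h)
    IsBRDF H k λ' {m} F =
      IsRDF H k λ' F
      × (∀ t i → ¬ H (F t i))
      × (∀ t t' → t ≢ t' → ∀ i j → ¬ (F t i ≈ F t' j))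
      × (∀ t t' → t ≢ t' → ∀ i j → ¬ ((F t i) ⁻¹ ≈ (F t' j) ⁻¹))
      × (∀ t t' i j → ¬ (F t i ≈ (F t' j) ⁻¹))

    HasBRDF : (H : Carrier → Set h) (k λ' : ℕ) → Set (c ⊔ ℓ ⊔ h)
    HasBRDF H k λ' = ∃[ m ] Σ (Fin m → Fin k → Carrier) (IsBRDF H k λ')

  -- M (k × n matrix, n = |G| forced by bijectivity) is a (G,k,1)-HDM
  IsHDM : (k n : ℕ) → (Fin k → Fin n → Carrier) → Set (c ⊔ ℓ)
  IsHDM k n M =
    (∀ r → Bijective _≡_ _≈_ (M r))
    × (∀ r r' → r ≢ r' → Bijective _≡_ _≈_ (λ col → diff (M r col) (M r' col)))

  HasHDM : (k : ℕ) → Set (c ⊔ ℓ)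
  HasHDM k = ∃[ n ] Σ (Fin k → Fin n → Carrier) (IsHDM k n)

_×G_ : Group c₁ ℓ₁ → Group c₂ ℓ₂ → Group (c₁ ⊔ c₂) (ℓ₁ ⊔ ℓ₂)
_×G_ = DP.group

×-dec≈ : (G₁ : Group c₁ ℓ₁) (G₂ : Group c₂ ℓ₂)
         → Decidable (Group._≈_ G₁) → Decidable (Group._≈_ G₂)
         → Decidable (Group._≈_ (G₁ ×G G₂))
×-dec≈ G₁ G₂ d₁ d₂ (a , b) (a' , b') = d₁ a a' ×-dec d₂ b b'

-- the subgroup H × G₂ of G₁ × G₂
_×all : {A B : Set c} → (A → Set h) → (A × B → Set h)
(H ×all) p = H (proj₁ p)

{-# OPTIONS --safe #-}
module Submission where

-- Replace every base block {b₁, …, b_k} of the BRDF by the n blocks {(b_i , M i c) : i < k}, one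
-- for each column c of the HDM M. A difference (g₁ , g₂) arises in the new blocks from positions
-- i ≠ j of an old block with b_i - b_j = g₁, once for every column c with M i c - M j c = g₂; as
-- the difference of two rows of M is a bijection there is exactly one such c, so (g₁ , g₂) is
-- counted exactly as often as g₁ was. Two elements (b , M i c) and (b' , M j c') can only agree
-- if b and b' are the same element of the same old block, so i = j, and then c = c' because the
-- rows of M are injective; the conditions on -B are inherited from the first coordinate.

open import Defs
open import Level using (Level)
open import Data.Nat using (ℕ; zero; suc; _+_; _*_; _≥_)
open import Data.Nat.Properties using (+-*-semiring; +-assoc; *-assoc; *-identityʳ)
open import Data.Fin as Fin using (Fin; _≟_; _↑ˡ_; _↑ʳ_; combine; remQuot; quotient; remainder; punchIn)
open import Data.Fin.Properties using (remQuot-combine; combine-remQuot; punchInᵢ≢i)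
open import Data.List using (List; []; _∷_; _++_; length; filter; concatMap; tabulate; allFin)
open import Data.List.Properties using (length-++; filter-++; concatMap-cong)
open import Data.Bool using (true; false)
open import Data.Product using (_×_; _,_; proj₁; proj₂; uncurry)
open import Function using (_∘_; id)
open import Function.Definitions using (Injective; Bijective)
open import Relation.Binary using (Rel; Decidable; Setoid)
open import Relation.Binary.PropositionalEquality
open import Relation.Nullary using (Dec; _because_; yes; no; ¬_; ¬?; contradiction; invert)
open import Relation.Nullary.Decidable using (_×-dec_)
open import Relation.Unary using (Pred)
open import Algebra.Bundles using (Group)
open import Algebra.Properties.Semiring.Sum +-*-semiring
  using (sum-syntax; sum-cong-≗; sum-replicate-zero; sum-remove; ∑-comm; *-distribˡ-sum)
import Algebra.Properties.Group as GroupProperties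

private variable
  a b p q r : Level
  A : Set a
  B : Set b
  Q : Set q

indicator : Dec A → ℕ
indicator (true  because _) = 1
indicator (false because _) = 0

indicator-yes : (a? : Dec A) → A → indicator a? ≡ 1
indicator-yes (true  because _)    _ = refl
indicator-yes (false because [¬a]) a = contradiction a (invert [¬a])

indicator-no : (a? : Dec A) → ¬ A → indicator a? ≡ 0
indicator-no (true  because [a]) ¬a = contradiction (invert [a]) ¬a
indicator-no (false because _)   _  = refl

indicator-×-dec : (a? : Dec A) (b? : Dec B) → indicator (a? ×-dec b?) ≡ indicator a? * indicator b?
indicator-×-dec (true  because _) (true  because _) = refl
indicator-×-dec (true  because _) (false because _) = refl
indicator-×-dec (false because _) _                 = refl

indicator-¬?-*-identityʳ : (q? : Dec Q) (x y : ℕ) → (¬ Q → y ≡ 1) →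
  indicator (¬? q?) * x * y ≡ indicator (¬? q?) * x
indicator-¬?-*-identityʳ (yes _) x y _   = refl
indicator-¬?-*-identityʳ (no ¬q) x y y≡1 = trans (cong (1 * x *_) (y≡1 ¬q)) (*-identityʳ (1 * x))

unless : Dec Q → A → List A
unless (yes _) x = []
unless (no _)  x = x ∷ []

module _ {P : Pred A p} (P? : ∀ x → Dec (P x)) where

  count-unless : (q? : Dec Q) (x : A) →
    length (filter P? (unless q? x)) ≡ indicator (¬? q?) * indicator (P? x)
  count-unless (yes _) x = refl
  count-unless (no _)  x with P? x
  ... | yes _ = refl
  ... | no  _ = refl

  count-concatMap-tabulate : ∀ {m} (f : B → List A) (g : Fin m → B) →
    length (filter P? (concatMap f (tabulate g))) ≡ ∑[ t < m ] length (filter P? (f (g t)))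
  count-concatMap-tabulate {m = zero}  f g = refl
  count-concatMap-tabulate {m = suc m} f g = begin
    length (filter P? (f (g Fin.zero) ++ rest))              ≡⟨ cong length (filter-++ P? (f (g Fin.zero)) rest) ⟩
    length (filter P? (f (g Fin.zero)) ++ filter P? rest)    ≡⟨ length-++ (filter P? (f (g Fin.zero))) ⟩
    length (filter P? (f (g Fin.zero))) + length (filter P? rest)
      ≡⟨ cong (length (filter P? (f (g Fin.zero))) +_) (count-concatMap-tabulate f (g ∘ Fin.suc)) ⟩
    ∑[ t < suc m ] length (filter P? (f (g t)))              ∎
    where
    open ≡-Reasoning
    rest = concatMap f (tabulate (g ∘ Fin.suc))

∑-indicator-unique : ∀ {n} {P : Pred (Fin n) p} (P? : ∀ x → Dec (P x)) {x₀ : Fin n} →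
  P x₀ → (∀ {x} → P x → x ≡ x₀) → ∑[ x < n ] indicator (P? x) ≡ 1
∑-indicator-unique {n = suc n} P? {x₀} px₀ unique = begin
  ∑[ x < suc n ] indicator (P? x)                              ≡⟨ sum-remove {i = x₀} (indicator ∘ P?) ⟩
  indicator (P? x₀) + ∑[ y < n ] indicator (P? (punchIn x₀ y)) ≡⟨ cong₂ _+_ (indicator-yes (P? x₀) px₀)
                                                                            (sum-cong-≗ vanishesElsewhere) ⟩
  1 + ∑[ y < n ] 0                                             ≡⟨ cong suc (sum-replicate-zero n) ⟩
  1                                                            ∎
  where
  open ≡-Reasoning
  vanishesElsewhere : ∀ y → indicator (P? (punchIn x₀ y)) ≡ 0
  vanishesElsewhere y = indicator-no (P? (punchIn x₀ y)) (punchInᵢ≢i x₀ y ∘ unique)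

module _ (S : Setoid a r) (_≈?_ : Decidable (Setoid._≈_ S)) where

  open Setoid S using (Carrier; _≈_) renaming (sym to ≈-sym; trans to ≈-trans)

  ∑-indicator-bijective : ∀ {n} {f : Fin n → Carrier} → Bijective _≡_ _≈_ f →
    ∀ y → ∑[ x < n ] indicator (f x ≈? y) ≡ 1
  ∑-indicator-bijective (injective , surjective) y =
    ∑-indicator-unique (λ x → _ ≈? y) (fx₀≈y refl) (λ fx≈y → injective (≈-trans fx≈y (≈-sym (fx₀≈y refl))))
    where
    fx₀≈y = proj₂ (surjective y)

∑-↑ : ∀ m n (f : Fin (m + n) → ℕ) →
  ∑[ i < m + n ] f i ≡ ∑[ i < m ] f (i ↑ˡ n) + ∑[ j < n ] f (m ↑ʳ j)
∑-↑ zero    n f = refl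
∑-↑ (suc m) n f = trans (cong (f Fin.zero +_) (∑-↑ m n (f ∘ Fin.suc))) (sym (+-assoc (f Fin.zero) _ _))

∑-combine : ∀ m n (f : Fin (m * n) → ℕ) → ∑[ i < m * n ] f i ≡ ∑[ t < m ] ∑[ c < n ] f (combine t c)
∑-combine zero    n f = refl
∑-combine (suc m) n f =
  trans (∑-↑ n (m * n) f) (cong (∑[ c < n ] f (c ↑ˡ m * n) +_) (∑-combine m n (f ∘ (n ↑ʳ_))))

∑-remQuot : ∀ m n (f : Fin m → Fin n → ℕ) →
  ∑[ i < m * n ] f (quotient n i) (remainder {m} n i) ≡ ∑[ t < m ] ∑[ c < n ] f t c
∑-remQuot m n f = trans (∑-combine m n (uncurry f ∘ remQuot n))
  (sum-cong-≗ λ t → sum-cong-≗ λ c → cong (uncurry f) (remQuot-combine t c))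

remQuot-injective : ∀ m n {i j : Fin (m * n)} → remQuot {m} n i ≡ remQuot n j → i ≡ j
remQuot-injective m n {i} {j} eq =
  trans (sym (combine-remQuot {m} n i)) (trans (cong (uncurry combine) eq) (combine-remQuot {m} n j))

module _ {_≈_ : Rel A r} {m k : ℕ} {F : Fin m → Fin k → A}
  (injective : ∀ t → Injective _≡_ _≈_ (F t))
  (disjoint : ∀ t t' → t ≢ t' → ∀ i j → ¬ (F t i ≈ F t' j)) where

  disjointBlocks-injective : ∀ {t t' i j} → F t i ≈ F t' j → t ≡ t' × i ≡ j
  disjointBlocks-injective {t} {t'} {i} {j} Fti≈Ft'j with t ≟ t'
  ... | yes refl = refl , injective t Fti≈Ft'j
  ... | no  t≢t' = contradiction Fti≈Ft'j (disjoint t t' t≢t' i j)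

module _ {c ℓ} (G : Group c ℓ) where

  open Group G using (Carrier; _≈_)

  differences : ∀ {m k} → (Fin m → Fin k → Carrier) → List Carrier
  differences {m} {k} F = concatMap (λ t → concatMap (λ i → concatMap (λ j →
    unless (i ≟ j) (diff G (F t i) (F t j))) (allFin k)) (allFin k)) (allFin m)

  -- `diffList` decides `i ≟ j` in a where-bound helper of `Defs` that cannot be named here, so the
  -- `_` in the statement of `pick≡unless` is that helper's list, found by unification with its use.
  mutual
    diffList≡differences : ∀ {m k} (F : Fin m → Fin k → Carrier) → diffList G F ≡ differences F
    diffList≡differences {m} {k} F =
      concatMap-cong (λ t → concatMap-cong (λ i → concatMap-cong (λ j → pick≡unless F t i j)
        (allFin k)) (allFin k)) (allFin m)

    pick≡unless : ∀ {m k} (F : Fin m → Fin k → Carrier) t (i j : Fin k) →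
      _ ≡ unless (i ≟ j) (diff G (F t i) (F t j))
    pick≡unless F t i j with i ≟ j
    ... | yes _ = refl
    ... | no  _ = refl

  multiplicity≡∑ : (_≈?_ : Decidable _≈_) {m k : ℕ} (F : Fin m → Fin k → Carrier) (g : Carrier) →
    multiplicity G _≈?_ F g ≡
      ∑[ t < m ] ∑[ i < k ] ∑[ j < k ] (indicator (¬? (i ≟ j)) * indicator (diff G (F t i) (F t j) ≈? g))
  multiplicity≡∑ _≈?_ {m} {k} F g =
    trans (cong (length ∘ filter P?) (diffList≡differences F))
    (trans (count-concatMap-tabulate P? {m = m} _ id) (sum-cong-≗ λ t →
     trans (count-concatMap-tabulate P? {m = k} _ id) (sum-cong-≗ λ i →
     trans (count-concatMap-tabulate P? {m = k} _ id) (sum-cong-≗ λ j →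
     count-unless P? (i ≟ j) (diff G (F t i) (F t j))))))
    where
    P? : ∀ x → Dec (x ≈ g)
    P? = _≈? g

module ProductConstruction {c ℓ} (G₁ G₂ : Group c ℓ)
  (_≈₁?_ : Decidable (Group._≈_ G₁)) (_≈₂?_ : Decidable (Group._≈_ G₂))
  {k m n : ℕ} (F : Fin m → Fin k → Group.Carrier G₁) (M : Fin k → Fin n → Group.Carrier G₂) where

  open Group G₁ using () renaming (Carrier to C₁; _≈_ to _≈₁_)
  open Group G₂ using () renaming (Carrier to C₂; _≈_ to _≈₂_)

  G : Group c ℓ
  G = G₁ ×G G₂

  open Group G using (_≈_)

  _≈?_ : Decidable _≈_
  _≈?_ = ×-dec≈ G₁ G₂ _≈₁?_ _≈₂?_

  productBlocks : Fin (m * n) → Fin k → C₁ × C₂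
  productBlocks b i = F (quotient n b) i , M i (remainder {m} n b)

  multiplicity-productBlocks :
    (∀ i j → i ≢ j → Bijective _≡_ _≈₂_ (λ c → diff G₂ (M i c) (M j c))) →
    ∀ g₁ g₂ → multiplicity G _≈?_ productBlocks (g₁ , g₂) ≡ multiplicity G₁ _≈₁?_ F g₁
  multiplicity-productBlocks rowDifferencesBijective g₁ g₂ = begin
    multiplicity G _≈?_ productBlocks (g₁ , g₂)
      ≡⟨ multiplicity≡∑ G _≈?_ productBlocks (g₁ , g₂) ⟩
    ∑[ b < m * n ] ∑[ i < k ] ∑[ j < k ] pairCount (quotient n b) (remainder {m} n b) i j
      ≡⟨ ∑-remQuot m n (λ t c → ∑[ i < k ] ∑[ j < k ] pairCount t c i j) ⟩
    ∑[ t < m ] ∑[ c < n ] ∑[ i < k ] ∑[ j < k ] pairCount t c i j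
      ≡⟨ sum-cong-≗ (λ t → trans (∑-comm (λ c i → ∑[ j < k ] pairCount t c i j))
                                 (sum-cong-≗ λ i → ∑-comm (λ c j → pairCount t c i j))) ⟩
    ∑[ t < m ] ∑[ i < k ] ∑[ j < k ] ∑[ c < n ] pairCount t c i j
      ≡⟨ sum-cong-≗ (λ t → sum-cong-≗ λ i → sum-cong-≗ λ j → ∑-pairCount t i j) ⟩
    ∑[ t < m ] ∑[ i < k ] ∑[ j < k ] pairCount₁ t i j
      ≡⟨ multiplicity≡∑ G₁ _≈₁?_ F g₁ ⟨
    multiplicity G₁ _≈₁?_ F g₁
      ∎
    where
    open ≡-Reasoning

    firstCoordinate? : (t : Fin m) (i j : Fin k) → Dec (diff G₁ (F t i) (F t j) ≈₁ g₁)
    firstCoordinate? t i j = diff G₁ (F t i) (F t j) ≈₁? g₁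

    secondCoordinate? : (i j : Fin k) (c : Fin n) → Dec (diff G₂ (M i c) (M j c) ≈₂ g₂)
    secondCoordinate? i j c = diff G₂ (M i c) (M j c) ≈₂? g₂

    pairCount₁ : Fin m → Fin k → Fin k → ℕ
    pairCount₁ t i j = indicator (¬? (i ≟ j)) * indicator (firstCoordinate? t i j)

    pairCount : Fin m → Fin n → Fin k → Fin k → ℕ
    pairCount t c i j = indicator (¬? (i ≟ j)) * indicator (firstCoordinate? t i j ×-dec secondCoordinate? i j c)

    ∑-pairCount : ∀ t i j → ∑[ c < n ] pairCount t c i j ≡ pairCount₁ t i j
    ∑-pairCount t i j = begin
      ∑[ c < n ] pairCount t c i j
        ≡⟨ sum-cong-≗ (λ c → trans (cong (indicator (¬? (i ≟ j)) *_) (indicator-×-dec _ (secondCoordinate? i j c)))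
                                   (sym (*-assoc (indicator (¬? (i ≟ j))) _ _))) ⟩
      ∑[ c < n ] (pairCount₁ t i j * indicator (secondCoordinate? i j c))
        ≡⟨ *-distribˡ-sum (pairCount₁ t i j) (indicator ∘ secondCoordinate? i j) ⟨
      pairCount₁ t i j * ∑[ c < n ] indicator (secondCoordinate? i j c)
        ≡⟨ indicator-¬?-*-identityʳ (i ≟ j) _ _ (λ i≢j →
             ∑-indicator-bijective (Group.setoid G₂) _≈₂?_ (rowDifferencesBijective i j i≢j) g₂) ⟩
      pairCount₁ t i j
        ∎

  productBlocks-injective :
    (∀ t → Injective _≡_ _≈₁_ (F t)) → (∀ t t' → t ≢ t' → ∀ i j → ¬ (F t i ≈₁ F t' j)) →
    (∀ i → Injective _≡_ _≈₂_ (M i)) →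
    ∀ {b b' i j} → productBlocks b i ≈ productBlocks b' j → b ≡ b' × i ≡ j
  productBlocks-injective blocksInjective blocksDisjoint rowsInjective {i = i} {j} (x≈x' , y≈y')
    with disjointBlocks-injective {_≈_ = _≈₁_} blocksInjective blocksDisjoint {i = i} {j} x≈x'
  ... | t≡t' , refl = remQuot-injective m n (cong₂ _,_ t≡t' (rowsInjective i y≈y')) , refl

  isBRDF : ∀ {h} {H : C₁ → Set h} →
    IsBRDF G₁ _≈₁?_ H k 1 F → IsHDM G₂ k n M → IsBRDF G _≈?_ (H ×all) k 1 productBlocks
  isBRDF ((blocksInjective , multiplicity∉H , multiplicity∈H) , avoidsH , disjoint , _ , disjoint±)
         (rowsBijective , rowDifferencesBijective) =
    ( (λ b → proj₂ ∘ injective)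
    , (λ (g₁ , g₂) g₁∉H → trans (multiplicity-productBlocks rowDifferencesBijective g₁ g₂) (multiplicity∉H g₁ g₁∉H))
    , (λ (g₁ , g₂) g₁∈H → trans (multiplicity-productBlocks rowDifferencesBijective g₁ g₂) (multiplicity∈H g₁ g₁∈H)) )
    , (λ b → avoidsH (quotient n b))
    , (λ b b' b≢b' i j → b≢b' ∘ proj₁ ∘ injective)
    , (λ b b' b≢b' i j → b≢b' ∘ proj₁ ∘ injective ∘ GroupProperties.⁻¹-injective G)
    , (λ b b' i j → disjoint± (quotient n b) (quotient n b') i j ∘ proj₁)
    where
    injective : ∀ {b b' i j} → productBlocks b i ≈ productBlocks b' j → b ≡ b' × i ≡ j
    injective = productBlocks-injective blocksInjective disjoint (proj₁ ∘ rowsBijective)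

-- Finiteness is carried by the index types Fin m and Fin n.
lemma4p18 : ∀ {c ℓ h : Level} (G₁ G₂ : Group c ℓ)
    (_≈₁?_ : Decidable (Group._≈_ G₁)) (_≈₂?_ : Decidable (Group._≈_ G₂))
    → IsFinite G₁ → IsFinite G₂
    → (H : Group.Carrier G₁ → Set h) → IsSubgroup G₁ H
    → (k : ℕ) → k ≥ 2
    → HasBRDF G₁ _≈₁?_ H k 1
    → HasHDM G₂ k
    → HasBRDF (G₁ ×G G₂) (×-dec≈ G₁ G₂ _≈₁?_ _≈₂?_) (H ×all) k 1
lemma4p18 G₁ G₂ _≈₁?_ _≈₂?_ _ _ H _ k _ (m , F , brdf) (n , M , hdm) =
  m * n , productBlocks , isBRDF brdf hdm
  where open ProductConstruction G₁ G₂ _≈₁?_ _≈₂?_ F M
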